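{- Let $m,n\geq 2$ and $k\geq 1$ be integers. The independence number of the graph $\Gamma^k_{m,n}(k)$ equals $\max\{k,n\}$.
   Context: $[t]=\{1,\dots,t\}$. The graph $\Gamma^k_{m,n}(k)$ has vertex set $\{(a,b,c):a\in[k],b\in[m],c\in[n]\}$, and $(a,b,c)\sim(a',b',c')$ iff either ($c=c'$ and $b\neq b'$) or ($c\neq c'$ and $a\neq a'$). The independence number $\alpha(X)$ of a graph is the maximum size of a set of pairwise non-adjacent vertices. -}

module Defs where

open import Data.Nat using (ℕ; _≤_)
open import Data.Fin using (Fin)
open import Data.Product using (_×_; _,_; ∃)
open import Data.Sum using (_⊎_)
open import Data.List using (List; length)
open import Data.List.Membership.Propositional using (_∈_)
open import Data.List.Relation.Unary.Unique.Propositional using (Unique)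
open import Relation.Nullary using (¬_)
open import Relation.Binary.PropositionalEquality using (_≡_; _≢_)

-- Vertices of Γ^k_{m,n}(k): triples (a,b,c) with a ∈ [k], b ∈ [m], c ∈ [n]
-- (encoded 0-based via Fin).
Vertex : ℕ → ℕ → ℕ → Set
Vertex k m n = Fin k × Fin m × Fin n

Adj : ∀ {k m n} → Vertex k m n → Vertex k m n → Set
Adj (a , b , c) (a' , b' , c') = (c ≡ c' × b ≢ b') ⊎ (c ≢ c' × a ≢ a')

IsIndependent : ∀ {k m n} → List (Vertex k m n) → Set
IsIndependent {k} {m} {n} S =
  Unique S × (∀ {u v : Vertex k m n} → u ∈ S → v ∈ S → ¬ Adj u v)

IndependenceNumber : ℕ → ℕ → ℕ → ℕ → Set
IndependenceNumber k m n r =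
  (∃ λ (S : List (Vertex k m n)) → IsIndependent S × length S ≡ r)
  × (∀ (S : List (Vertex k m n)) → IsIndependent S → length S ≤ r)

-- Two non-adjacent vertices in the same column c agree in b, and two in different
-- columns agree in a. Hence an independent set either lies in one column, where a
-- determines the vertex, or meets two columns; in the latter case all its vertices
-- share one a (a vertex in the column of one of them is in a different column from
-- the other), so c determines the vertex. Either way it has at most k ⊔ n elements,
-- and the sets {(a₀, b₀, c)} and {(a, b₀, c₀)} attain n resp. k.
module Submission where

open import Defs
open import Data.Nat using (ℕ; _≤_; _⊔_; s≤s)
open import Data.Nat.Properties using (≮⇒≥; ≤-trans; m≤m⊔n; m≤n⊔m; ⊔-sel)
open import Data.Fin using (Fin; zero; suc)
open import Data.Fin.Properties using (pigeonhole; <⇒≢; _≟_)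
open import Data.Product using (_×_; _,_; ∃)
open import Data.Sum using (_⊎_; inj₁; inj₂)
open import Data.List using (List; []; _∷_; length; lookup; tabulate)
open import Data.List.Properties using (length-tabulate)
open import Data.List.Membership.Propositional using (_∈_; find)
open import Data.List.Membership.Propositional.Properties using (∈-lookup; ∈-tabulate⁻)
open import Data.List.Relation.Unary.All as All using (all?)
open import Data.List.Relation.Unary.All.Properties using (¬All⇒Any¬)
open import Data.List.Relation.Unary.AllPairs using (_∷_)
open import Data.List.Relation.Unary.Any using (here)
open import Data.List.Relation.Unary.Unique.Propositional using (Unique)
open import Data.List.Relation.Unary.Unique.Propositional.Properties using (tabulate⁺)
open import Relation.Nullary using (¬_; yes; no)
open import Relation.Nullary.Decidable using (decidable-stable)
open import Relation.Nullary.Negation using (contradiction)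
open import Relation.Binary.PropositionalEquality using (_≡_; _≢_; refl; sym; trans; cong)

lookup-injective : ∀ {A : Set} {xs : List A} → Unique xs →
                   ∀ {i j} → lookup xs i ≡ lookup xs j → i ≡ j
lookup-injective (_ ∷ _)    {zero}  {zero}  _  = refl
lookup-injective (x∉ ∷ _)   {zero}  {suc j} eq = contradiction eq (All.lookup x∉ (∈-lookup j))
lookup-injective (x∉ ∷ _)   {suc i} {zero}  eq = contradiction (sym eq) (All.lookup x∉ (∈-lookup i))
lookup-injective (_ ∷ uniq) {suc i} {suc j} eq = cong suc (lookup-injective uniq eq)

length≤-injectiveOn : ∀ {A : Set} {N} {xs : List A} → Unique xs → (f : A → Fin N) →
                      (∀ {u v} → u ∈ xs → v ∈ xs → f u ≡ f v → u ≡ v) → length xs ≤ N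
length≤-injectiveOn {xs = xs} uniq f f-inj = ≮⇒≥ λ N<len →
  let i , j , i<j , fi≡fj = pigeonhole N<len (λ i → f (lookup xs i))
  in  <⇒≢ i<j (lookup-injective uniq (f-inj (∈-lookup i) (∈-lookup j) fi≡fj))

module _ {k m n : ℕ} where

  a-of : Vertex k m n → Fin k
  a-of (a , _ , _) = a

  b-of : Vertex k m n → Fin m
  b-of (_ , b , _) = b

  c-of : Vertex k m n → Fin n
  c-of (_ , _ , c) = c

  Vertex-≡ : ∀ {u v : Vertex k m n} →
             a-of u ≡ a-of v → b-of u ≡ b-of v → c-of u ≡ c-of v → u ≡ v
  Vertex-≡ refl refl refl = refl

  ¬Adj∧≡c⇒≡b : ∀ {u v : Vertex k m n} → ¬ Adj u v → c-of u ≡ c-of v → b-of u ≡ b-of v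
  ¬Adj∧≡c⇒≡b {u} {v} u≁v c≡ = decidable-stable (b-of u ≟ b-of v) (λ b≢ → u≁v (inj₁ (c≡ , b≢)))

  ¬Adj∧≢c⇒≡a : ∀ {u v : Vertex k m n} → ¬ Adj u v → c-of u ≢ c-of v → a-of u ≡ a-of v
  ¬Adj∧≢c⇒≡a {u} {v} u≁v c≢ = decidable-stable (a-of u ≟ a-of v) (λ a≢ → u≁v (inj₂ (c≢ , a≢)))

  ConstantOn : ∀ {X : Set} → (Vertex k m n → X) → List (Vertex k m n) → Set
  ConstantOn f S = ∀ {u v} → u ∈ S → v ∈ S → f u ≡ f v

  independent⇒constant-c⊎constant-a : ∀ {S} → IsIndependent S → ConstantOn c-of S ⊎ ConstantOn a-of S
  independent⇒constant-c⊎constant-a {[]} _ = inj₁ λ ()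
  independent⇒constant-c⊎constant-a {x ∷ xs} (_ , indep)
    with all? (λ w → c-of w ≟ c-of x) (x ∷ xs)
  ... | yes all≡c = inj₁ λ u∈ v∈ → trans (All.lookup all≡c u∈) (sym (All.lookup all≡c v∈))
  ... | no ¬all≡c = inj₂ λ u∈ v∈ → trans (a≡a-of-x u∈) (sym (a≡a-of-x v∈))
    where
    x∈ : x ∈ x ∷ xs
    x∈ = here refl

    a≡a-of-x : ∀ {y} → y ∈ x ∷ xs → a-of y ≡ a-of x
    a≡a-of-x {y} y∈ with find (¬All⇒Any¬ (λ w → c-of w ≟ c-of x) (x ∷ xs) ¬all≡c) | c-of y ≟ c-of x
    ... | _ | no c≢ = ¬Adj∧≢c⇒≡a (indep y∈ x∈) c≢
    ... | w , w∈ , w≢x | yes c≡ =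
      trans (¬Adj∧≢c⇒≡a (indep y∈ w∈) (λ y≡w → w≢x (trans (sym y≡w) c≡)))
            (¬Adj∧≢c⇒≡a (indep w∈ x∈) w≢x)

  independent⇒length≤k⊔n : ∀ {S} → IsIndependent S → length S ≤ k ⊔ n
  independent⇒length≤k⊔n S-indep@(uniq , indep) with independent⇒constant-c⊎constant-a S-indep
  ... | inj₁ c-const = ≤-trans (length≤-injectiveOn uniq a-of λ u∈ v∈ a≡ →
                                  let c≡ = c-const u∈ v∈ in Vertex-≡ a≡ (¬Adj∧≡c⇒≡b (indep u∈ v∈) c≡) c≡)
                                (m≤m⊔n k n)
  ... | inj₂ a-const = ≤-trans (length≤-injectiveOn uniq c-of λ u∈ v∈ c≡ →
                                  Vertex-≡ (a-const u∈ v∈) (¬Adj∧≡c⇒≡b (indep u∈ v∈) c≡) c≡)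
                                (m≤n⊔m k n)

  IndependentSetOfSize : ℕ → Set
  IndependentSetOfSize r = ∃ λ (S : List (Vertex k m n)) → IsIndependent S × length S ≡ r

  tabulate-independent : ∀ {N} (f : Fin N → Vertex k m n) → (∀ {i j} → f i ≡ f j → i ≡ j) →
                         (∀ i j → ¬ Adj (f i) (f j)) → IndependentSetOfSize N
  tabulate-independent f f-inj f-indep = tabulate f , (tabulate⁺ f-inj , indep) , length-tabulate f
    where
    indep : ∀ {u v} → u ∈ tabulate f → v ∈ tabulate f → ¬ Adj u v
    indep u∈ v∈ with ∈-tabulate⁻ u∈ | ∈-tabulate⁻ v∈
    ... | i , refl | j , refl = f-indep i j

  column-independent : Fin k → Fin m → IndependentSetOfSize n
  column-independent a b = tabulate-independent (λ c → a , b , c) (cong c-of) λ where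
    _ _ (inj₁ (_ , b≢)) → b≢ refl
    _ _ (inj₂ (_ , a≢)) → a≢ refl

  row-independent : Fin m → Fin n → IndependentSetOfSize k
  row-independent b c = tabulate-independent (λ a → a , b , c) (cong a-of) λ where
    _ _ (inj₁ (_ , b≢)) → b≢ refl
    _ _ (inj₂ (c≢ , _)) → c≢ refl

  independenceNumber-k⊔n : Fin k → Fin m → Fin n → IndependenceNumber k m n (k ⊔ n)
  independenceNumber-k⊔n a b c = attained (⊔-sel k n) , λ S → independent⇒length≤k⊔n
    where
    attained : ∀ {r} → r ≡ k ⊎ r ≡ n → IndependentSetOfSize r
    attained (inj₁ refl) = row-independent b c
    attained (inj₂ refl) = column-independent a b

lemma3p4 : (k m n : ℕ) → 2 ≤ m → 2 ≤ n → 1 ≤ k →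
    IndependenceNumber k m n (k ⊔ n)
lemma3p4 _ _ _ (s≤s _) (s≤s _) (s≤s _) = independenceNumber-k⊔n zero zero zero
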